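{- Let $n\ge2$, $\boldsymbol a\in\{0,1\}^{n-1}$, $\vec\sigma\in\{0,1\}^n$, and let $\mu_{\boldsymbol j,\boldsymbol m}$ be the Haar coefficients of $\Delta(\cdot,\mathcal{P}_{\boldsymbol a}(\vec\sigma))$. Then for $\boldsymbol j=(0,n-1)$, $$2^{n-1}\sum_{m_2=0}^{2^{n-1}-1}|\mu_{\boldsymbol j,(0,m_2)}|^2=\frac13\,2^{ -4n-6}\bigl(2^{2n}+8\bigr).$$
   Context: $\oplus$ denotes addition modulo 2. For an integer $n\ge1$, $\boldsymbol{a}=(a_1,\dots,a_{n-1})\in\{0,1\}^{n-1}$ and $\vec{\sigma}=(\sigma_1,\dots,\sigma_n)\in\{0,1\}^n$, let $\mathcal{P}_{\boldsymbol{a}}(\vec{\sigma})\subset[0,1)^2$ be the set of the $2^n$ points $\bigl(\frac{t_n}{2}+\dots+\frac{t_1}{2^n},\ \frac{b_1}{2}+\dots+\frac{b_n}{2^n}\bigr)$, $(t_1,\dots,t_n)\in\{0,1\}^n$, with $b_k=t_k\oplus a_kt_n\oplus\sigma_k$ for $1\le k\le n-1$ and $b_n=t_n\oplus\sigma_n$. For an $N$-point set $\mathcal{P}$ the discrepancy function is $\Delta(\boldsymbol{t},\mathcal{P})=\frac1N\#\{\boldsymbol{z}\in\mathcal{P}:\boldsymbol{z}\in[0,t_1)\times[0,t_2)\}-t_1t_2$. Haar functions: for $j\ge0$, $m\in\{0,\dots,2^j-1\}$, $h_{j,m}$ is $+1$ on $[m2^{ -j},(m+\frac12)2^{ -j})$,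 $-1$ on $[(m+\frac12)2^{ -j},(m+1)2^{ -j})$ and $0$ elsewhere on $[0,1)$. For $\boldsymbol j=(j_1,j_2)$, $\boldsymbol m=(m_1,m_2)$, $h_{\boldsymbol j,\boldsymbol m}(\boldsymbol t)=h_{j_1,m_1}(t_1)h_{j_2,m_2}(t_2)$ and $\mu_{\boldsymbol j,\boldsymbol m}=\int_{[0,1)^2}\Delta(\boldsymbol t,\mathcal P)h_{\boldsymbol j,\boldsymbol m}(\boldsymbol t)\,d\boldsymbol t$. -}

module Defs where

open import Data.Bool using (Bool; true; false; _xor_; _∧_)
open import Data.Nat as ℕ using (ℕ; zero; suc; _^_; _∸_)
open import Data.Nat.Properties using (m^n≢0)
open import Data.Integer as ℤ using (ℤ; +_)
open import Data.Rational using (ℚ; 0ℚ; 1ℚ; _+_; _*_; _-_; _⊔_; _/_)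
open import Data.List using (List; []; _∷_; map; foldr; length; _++_; upTo)
open import Data.Vec using (Vec; []; _∷_; init; last; zipWith; _∷ʳ_)
open import Data.Product using (_×_; _,_; proj₁; proj₂)

sumℚ : List ℚ → ℚ
sumℚ = foldr _+_ 0ℚ

ℕ→ℚ : ℕ → ℚ
ℕ→ℚ k = (+ k) / 1

bit : Bool → ℚ
bit true  = 1ℚ
bit false = 0ℚ

2^-_ : ℕ → ℚ
2^- k = (+ 1) / (2 ^ k) where instance _ = m^n≢0 2 k

allVecs : (n : ℕ) → List (Vec Bool n)
allVecs zero    = [] ∷ []
allVecs (suc n) = map (false ∷_) (allVecs n) ++ map (true ∷_) (allVecs n)

binFrac : ∀ {n} → Vec Bool n → ℚ
binFrac []       = 0ℚ
binFrac (v ∷ vs) = 2^- 1 * (bit v + binFrac vs)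

rev : ∀ {n} → Vec Bool n → Vec Bool n
rev []       = []
rev (x ∷ xs) = rev xs ∷ʳ x

-- The point of P_a(σ) with parameter t = (t_1,...,t_n):
--   x = t_n/2 + ... + t_1/2^n,   y = b_1/2 + ... + b_n/2^n,
--   b_k = t_k ⊕ a_k t_n ⊕ σ_k (k ≤ n-1),  b_n = t_n ⊕ σ_n.
point : ∀ {m} → Vec Bool m → Vec Bool (suc m) → Vec Bool (suc m) → ℚ × ℚ
point {m} a σ t =
  let tn = last t
      b  = zipWith _xor_ (zipWith _xor_ (init t) (zipWith _∧_ a (Data.Vec.replicate m tn))) (init σ)
           ∷ʳ (tn xor last σ)
  in binFrac (rev t) , binFrac b

-- The point set P_a(σ) (a list of 2^n points, one per t ∈ {0,1}^n).
-- For n = 0 it is not used (n ≥ 2 in the statement).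
pointSet : (n : ℕ) → Vec Bool (n ∸ 1) → Vec Bool n → List (ℚ × ℚ)
pointSet zero    a σ = []
pointSet (suc m) a σ = map (point a σ) (allVecs (suc m))

-- Haar function h_{j,m}: +1 on [lo,mid), -1 on [mid,hi)
haarLo : ℕ → ℕ → ℚ
haarMid : ℕ → ℕ → ℚ
haarHi : ℕ → ℕ → ℚ
haarLo  j m = ℕ→ℚ m * 2^- j
haarMid j m = ℕ→ℚ (2 ℕ.* m ℕ.+ 1) * 2^- (suc j)
haarHi  j m = ℕ→ℚ (suc m) * 2^- j

-- ∫_0^1 1[z < t] 1[lo ≤ t < hi] dt = length of [lo,hi) ∩ (z,1)  (for hi ≤ 1)
ovl : ℚ → ℚ → ℚ → ℚ
ovl z lo hi = 0ℚ ⊔ (hi - (lo ⊔ z))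

-- ∫_0^1 1[z < t] h_{j,m}(t) dt
tailInt : ℕ → ℕ → ℚ → ℚ
tailInt j m z = ovl z (haarLo j m) (haarMid j m) - ovl z (haarMid j m) (haarHi j m)

-- ∫_0^1 t h_{j,m}(t) dt = (c²-a²)/2 - (b²-c²)/2  with [a,c),[c,b) the two halves
momentInt : ℕ → ℕ → ℚ
momentInt j m =
  let a = haarLo j m ; c = haarMid j m ; b = haarHi j m
  in 2^- 1 * ((c * c - a * a) - (b * b - c * c))

-- Haar coefficient μ_{j,m} = ∫_{[0,1)^2} Δ(t,P) h_{j,m}(t) dt, written out exactly:
-- Δ(t,P) = (1/N) Σ_{z∈P} 1[z₁<t₁]1[z₂<t₂] - t₁t₂, and each term factorizes (Fubini).
haarCoeff : List (ℚ × ℚ) → (ℕ × ℕ) → (ℕ × ℕ) → ℚ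
haarCoeff P (j₁ , j₂) (m₁ , m₂) =
  (+ 1) / suc (length P ∸ 1) -- = 1/N for N ≥ 1
    * sumℚ (map (λ z → tailInt j₁ m₁ (proj₁ z) * tailInt j₂ m₂ (proj₂ z)) P)
  - momentInt j₁ m₁ * momentInt j₂ m₂

{-# OPTIONS --safe #-}
module Submission where

open import Defs

-- Write q = 2^-n and t = u ∷ʳ tₙ. In the second variable, ∫ 1[y < t] h_{n-1,M}(t) dt vanishes at every
-- grid point y except the midpoint of the support of h_{n-1,M}, where it is -q. For each tₙ the digit map
-- u ↦ (b₁, …, b_{n-1}) is a bijection, so exactly one point of P_a(σ) sits at that midpoint: the one with
-- tₙ = ¬σₙ and (b₁, …, b_{n-1}) the digits of M. Its x-coordinate is Vq or 1/2 + Vq with 0 ≤ V < 2^{n-1},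
-- and in both cases μ_{(0,n-1),(0,M)} = ±q²(Vq - 1/4). As M runs over [0, 2^{n-1}) so does V, so the sum
-- is one of squares over an arithmetic progression.

-- A module only so that ℚ's operators can be opened unqualified; the statement of lemma10 uses ℕ's.
module HaarSquareSum where

  open import Data.Bool using (Bool; true; false; not; _∧_; _xor_; if_then_else_)
  import Data.Bool.Properties as BoolP
  open import Data.Empty using (⊥-elim)
  open import Data.Integer as ℤ using ()
  import Data.Integer.Properties as ℤP
  open import Data.Integer.GCD using (gcd)
  open import Data.List using (List; []; _∷_; [_]; map; _++_; upTo; applyUpTo; length)
  import Data.List.Properties as ListP
  open import Data.Nat as ℕ using (ℕ; zero; suc; _^_; _∸_)
  import Data.Nat.Properties as ℕP
  open import Data.Nat.Tactic.RingSolver using (solve-∀)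
  open import Data.Product using (_×_; _,_; proj₁; proj₂)
  open import Data.Rational as ℚ using (ℚ; mkℚ; toℚᵘ; 0ℚ; 1ℚ; _/_; _+_; _*_; _-_; -_; _⊔_; _≤_)
  open import Data.Rational.Properties
  open import Data.Rational.Solver using (module +-*-Solver)
  open import Data.Rational.Unnormalised as ℚᵘ using (mkℚᵘ; *≡*)
  import Data.Rational.Unnormalised.Properties as ℚᵘP
  open import Data.Sum using (inj₁; inj₂)
  open import Data.Vec using (Vec; []; _∷_; _∷ʳ_; zipWith; replicate; init; last)
  import Data.Vec.Properties as VecP
  open import Function using (_∘_; id; _⇔_; mk⇔)
  open import Relation.Binary.Definitions using (DecidableEquality; tri<; tri≈; tri>)
  open import Relation.Binary.PropositionalEquality hiding ([_])
  open import Relation.Nullary.Decidable using (does; dec-true; dec-false; does-⇔)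
  open +-*-Solver

  -- Dyadic rationals

  toℚᵘ-/ : ∀ i n .{{_ : ℕ.NonZero n}} → toℚᵘ (i / n) ℚᵘ.≃ mkℚᵘ i (ℕ.pred n)
  toℚᵘ-/ i n with i / n | ↥-/ i n | ↧-/ i n
  ... | mkℚ a b _ | ↥[i/n]*g≡i | ↧[i/n]*g≡n = *≡* (begin
      a ℤ.* ℤ.+ suc (ℕ.pred n)  ≡⟨ cong (λ k → a ℤ.* ℤ.+ k) (ℕP.suc-pred n) ⟩
      a ℤ.* ℤ.+ n               ≡⟨ cong (a ℤ.*_) (sym ↧[i/n]*g≡n) ⟩
      a ℤ.* (ℤ.+ suc b ℤ.* g)   ≡⟨ cong (a ℤ.*_) (ℤP.*-comm (ℤ.+ suc b) g) ⟩
      a ℤ.* (g ℤ.* ℤ.+ suc b)   ≡⟨ sym (ℤP.*-assoc a g (ℤ.+ suc b)) ⟩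
      a ℤ.* g ℤ.* ℤ.+ suc b     ≡⟨ cong (ℤ._* ℤ.+ suc b) ↥[i/n]*g≡i ⟩
      i ℤ.* ℤ.+ suc b           ∎)
    where
    open ≡-Reasoning
    g = gcd i (ℤ.+ n)

  ℕ→ℚ-homo-+ : ∀ a b → ℕ→ℚ (a ℕ.+ b) ≡ ℕ→ℚ a + ℕ→ℚ b
  ℕ→ℚ-homo-+ a b = toℚᵘ-injective (begin
    toℚᵘ (ℕ→ℚ (a ℕ.+ b))                ≈⟨ toℚᵘ-/ (ℤ.+ (a ℕ.+ b)) 1 ⟩
    mkℚᵘ (ℤ.+ (a ℕ.+ b)) 0               ≈⟨ *≡* (cong (ℤ._* ℤ.+ 1) pos-sum) ⟩
    mkℚᵘ (ℤ.+ a) 0 ℚᵘ.+ mkℚᵘ (ℤ.+ b) 0   ≈⟨ ℚᵘP.≃-sym (ℚᵘP.+-cong (toℚᵘ-/ (ℤ.+ a) 1) (toℚᵘ-/ (ℤ.+ b) 1)) ⟩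
    toℚᵘ (ℕ→ℚ a) ℚᵘ.+ toℚᵘ (ℕ→ℚ b)      ≈⟨ ℚᵘP.≃-sym (toℚᵘ-homo-+ (ℕ→ℚ a) (ℕ→ℚ b)) ⟩
    toℚᵘ (ℕ→ℚ a + ℕ→ℚ b)                ∎)
    where
    open ℚᵘP.≃-Reasoning
    pos-sum : ℤ.+ (a ℕ.+ b) ≡ ℤ.+ a ℤ.* ℤ.+ 1 ℤ.+ ℤ.+ b ℤ.* ℤ.+ 1
    pos-sum = trans (ℤP.pos-+ a b) (sym (cong₂ ℤ._+_ (ℤP.*-identityʳ (ℤ.+ a)) (ℤP.*-identityʳ (ℤ.+ b))))

  ℕ→ℚ-homo-* : ∀ a b → ℕ→ℚ (a ℕ.* b) ≡ ℕ→ℚ a * ℕ→ℚ b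
  ℕ→ℚ-homo-* a b = toℚᵘ-injective (begin
    toℚᵘ (ℕ→ℚ (a ℕ.* b))                ≈⟨ toℚᵘ-/ (ℤ.+ (a ℕ.* b)) 1 ⟩
    mkℚᵘ (ℤ.+ (a ℕ.* b)) 0               ≈⟨ *≡* (cong (ℤ._* ℤ.+ 1) (ℤP.pos-* a b)) ⟩
    mkℚᵘ (ℤ.+ a) 0 ℚᵘ.* mkℚᵘ (ℤ.+ b) 0   ≈⟨ ℚᵘP.≃-sym (ℚᵘP.*-cong (toℚᵘ-/ (ℤ.+ a) 1) (toℚᵘ-/ (ℤ.+ b) 1)) ⟩
    toℚᵘ (ℕ→ℚ a) ℚᵘ.* toℚᵘ (ℕ→ℚ b)      ≈⟨ ℚᵘP.≃-sym (toℚᵘ-homo-* (ℕ→ℚ a) (ℕ→ℚ b)) ⟩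
    toℚᵘ (ℕ→ℚ a * ℕ→ℚ b)                ∎)
    where open ℚᵘP.≃-Reasoning

  ℕ→ℚ-suc : ∀ k → ℕ→ℚ (suc k) ≡ 1ℚ + ℕ→ℚ k
  ℕ→ℚ-suc = ℕ→ℚ-homo-+ 1

  ℕ→ℚ-homo-∸ : ∀ {a b} → b ℕ.≤ a → ℕ→ℚ (a ∸ b) ≡ ℕ→ℚ a - ℕ→ℚ b
  ℕ→ℚ-homo-∸ {a} {b} b≤a = begin
    ℕ→ℚ (a ∸ b)                          ≡⟨ solve 2 (λ x y → y := x :+ y :- x) refl (ℕ→ℚ b) (ℕ→ℚ (a ∸ b)) ⟩
    ℕ→ℚ b + ℕ→ℚ (a ∸ b) - ℕ→ℚ b          ≡⟨ cong (_- ℕ→ℚ b) (sym (ℕ→ℚ-homo-+ b (a ∸ b))) ⟩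
    ℕ→ℚ (b ℕ.+ (a ∸ b)) - ℕ→ℚ b          ≡⟨ cong (λ k → ℕ→ℚ k - ℕ→ℚ b) (ℕP.m+[n∸m]≡n b≤a) ⟩
    ℕ→ℚ a - ℕ→ℚ b                        ∎
    where open ≡-Reasoning

  ℕ→ℚ-mono-≤ : ∀ {a b} → a ℕ.≤ b → ℕ→ℚ a ≤ ℕ→ℚ b
  ℕ→ℚ-mono-≤ {a} {b} a≤b = begin
    ℕ→ℚ a                  ≡⟨ sym (+-identityʳ (ℕ→ℚ a)) ⟩
    ℕ→ℚ a + 0ℚ             ≤⟨ +-monoʳ-≤ (ℕ→ℚ a) (nonNegative⁻¹ _ {{normalize-nonNeg (b ∸ a) 1}}) ⟩
    ℕ→ℚ a + ℕ→ℚ (b ∸ a)    ≡⟨ sym (ℕ→ℚ-homo-+ a (b ∸ a)) ⟩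
    ℕ→ℚ (a ℕ.+ (b ∸ a))    ≡⟨ cong ℕ→ℚ (ℕP.m+[n∸m]≡n a≤b) ⟩
    ℕ→ℚ b                  ∎
    where open ≤-Reasoning

  *-inverse-unique : ∀ {x y z} → y * x ≡ 1ℚ → z * x ≡ 1ℚ → y ≡ z
  *-inverse-unique {x} {y} {z} yx≡1 zx≡1 = begin
    y                ≡⟨ sym (*-identityʳ y) ⟩
    y * 1ℚ           ≡⟨ cong (y *_) (sym zx≡1) ⟩
    y * (z * x)      ≡⟨ solve 3 (λ x y z → y :* (z :* x) := z :* (y :* x)) refl x y z ⟩
    z * (y * x)      ≡⟨ cong (z *_) yx≡1 ⟩
    z * 1ℚ           ≡⟨ *-identityʳ z ⟩
    z                ∎
    where open ≡-Reasoning

  2^-k*2^k≡1 : ∀ k → 2^- k * ℕ→ℚ (2 ^ k) ≡ 1ℚ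
  2^-k*2^k≡1 k = toℚᵘ-injective (begin
    toℚᵘ (2^- k * ℕ→ℚ d)                          ≈⟨ toℚᵘ-homo-* (2^- k) (ℕ→ℚ d) ⟩
    toℚᵘ (2^- k) ℚᵘ.* toℚᵘ (ℕ→ℚ d)                ≈⟨ ℚᵘP.*-cong (toℚᵘ-/ (ℤ.+ 1) d) (toℚᵘ-/ (ℤ.+ d) 1) ⟩
    mkℚᵘ (ℤ.+ 1) (ℕ.pred d) ℚᵘ.* mkℚᵘ (ℤ.+ d) 0   ≈⟨ *≡* cross ⟩
    ℚᵘ.1ℚᵘ                                        ∎)
    where
    open ℚᵘP.≃-Reasoning
    d = 2 ^ k
    instance _ = ℕP.m^n≢0 2 k
    cross : (ℤ.+ 1 ℤ.* ℤ.+ d) ℤ.* ℤ.+ 1 ≡ ℤ.+ 1 ℤ.* (ℤ.+ (suc (ℕ.pred d) ℕ.* 1))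
    cross = trans (ℤP.*-identityʳ _) (trans (ℤP.*-identityˡ (ℤ.+ d))
              (sym (trans (ℤP.*-identityˡ _) (cong ℤ.+_ (trans (ℕP.*-identityʳ _) (ℕP.suc-pred d))))))

  2^-‿+ : ∀ a b → 2^- (a ℕ.+ b) ≡ 2^- a * 2^- b
  2^-‿+ a b = *-inverse-unique (2^-k*2^k≡1 (a ℕ.+ b)) (begin
    2^- a * 2^- b * ℕ→ℚ (2 ^ (a ℕ.+ b))              ≡⟨ cong (λ k → 2^- a * 2^- b * ℕ→ℚ k) (ℕP.^-distribˡ-+-* 2 a b) ⟩
    2^- a * 2^- b * ℕ→ℚ (2 ^ a ℕ.* 2 ^ b)            ≡⟨ cong (2^- a * 2^- b *_) (ℕ→ℚ-homo-* (2 ^ a) (2 ^ b)) ⟩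
    2^- a * 2^- b * (ℕ→ℚ (2 ^ a) * ℕ→ℚ (2 ^ b))      ≡⟨ solve 4 (λ p q x y → p :* q :* (x :* y) := (p :* x) :* (q :* y)) refl
                                                             (2^- a) (2^- b) (ℕ→ℚ (2 ^ a)) (ℕ→ℚ (2 ^ b)) ⟩
    (2^- a * ℕ→ℚ (2 ^ a)) * (2^- b * ℕ→ℚ (2 ^ b))    ≡⟨ cong₂ _*_ (2^-k*2^k≡1 a) (2^-k*2^k≡1 b) ⟩
    1ℚ * 1ℚ                                          ≡⟨⟩
    1ℚ                                               ∎)
    where open ≡-Reasoning

  2^-nonNeg : ∀ k → 0ℚ ≤ 2^- k
  2^-nonNeg k = nonNegative⁻¹ _ {{normalize-nonNeg 1 (2 ^ k) {{ℕP.m^n≢0 2 k}}}}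

  ½ ¼ : ℚ
  ½ = 2^- 1
  ¼ = 2^- 2

  -- Grids of mesh q

  infixl 7.5 _⋆_
  _⋆_ : ℕ → ℚ → ℚ
  k ⋆ q = ℕ→ℚ k * q

  ⋆-homo-∸ : ∀ {a b} q → b ℕ.≤ a → (a ∸ b) ⋆ q ≡ a ⋆ q - b ⋆ q
  ⋆-homo-∸ {a} {b} q b≤a = trans (cong (_* q) (ℕ→ℚ-homo-∸ b≤a))
    (solve 3 (λ x y q → (x :- y) :* q := x :* q :- y :* q) refl (ℕ→ℚ a) (ℕ→ℚ b) q)

  2^m⋆2^-[1+m]≡½ : ∀ m → 2 ^ m ⋆ 2^- suc m ≡ ½
  2^m⋆2^-[1+m]≡½ m = begin
    ℕ→ℚ (2 ^ m) * 2^- suc m          ≡⟨ cong (ℕ→ℚ (2 ^ m) *_) (2^-‿+ 1 m) ⟩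
    ℕ→ℚ (2 ^ m) * (½ * 2^- m)        ≡⟨ solve 3 (λ n h p → n :* (h :* p) := h :* (p :* n)) refl (ℕ→ℚ (2 ^ m)) ½ (2^- m) ⟩
    ½ * (2^- m * ℕ→ℚ (2 ^ m))        ≡⟨ cong (½ *_) (2^-k*2^k≡1 m) ⟩
    ½ * 1ℚ                           ≡⟨⟩
    ½                                ∎
    where open ≡-Reasoning

  ⋆-refine : ∀ k j → k ⋆ 2^- j ≡ (2 ℕ.* k) ⋆ 2^- suc j
  ⋆-refine k j = begin
    ℕ→ℚ k * 2^- j                      ≡⟨ solve 2 (λ x p → x :* p := con (ℕ→ℚ 2) :* x :* (con ½ :* p)) refl (ℕ→ℚ k) (2^- j) ⟩
    ℕ→ℚ 2 * ℕ→ℚ k * (½ * 2^- j)       ≡⟨ cong₂ _*_ (sym (ℕ→ℚ-homo-* 2 k)) (sym (2^-‿+ 1 j)) ⟩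
    ℕ→ℚ (2 ℕ.* k) * 2^- suc j          ∎
    where open ≡-Reasoning

  module _ {q : ℚ} (0≤q : 0ℚ ≤ q) where

    ⋆-mono-≤ : ∀ {a b} → a ℕ.≤ b → a ⋆ q ≤ b ⋆ q
    ⋆-mono-≤ a≤b = *-monoʳ-≤-nonNeg q {{ℚ.nonNegative 0≤q}} (ℕ→ℚ-mono-≤ a≤b)

    ⋆-nonNeg : ∀ k → 0ℚ ≤ k ⋆ q
    ⋆-nonNeg k = ≤-trans (≤-reflexive (sym (*-zeroˡ q))) (⋆-mono-≤ {b = k} ℕ.z≤n)

    ⋆-distrib-⊔ : ∀ a b → a ⋆ q ⊔ b ⋆ q ≡ (a ℕ.⊔ b) ⋆ q
    ⋆-distrib-⊔ a b with ℕP.≤-total a b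
    ... | inj₁ a≤b = trans (p≤q⇒p⊔q≡q (⋆-mono-≤ a≤b)) (cong (_⋆ q) (sym (ℕP.m≤n⇒m⊔n≡n a≤b)))
    ... | inj₂ b≤a = trans (p≥q⇒p⊔q≡p (⋆-mono-≤ b≤a)) (cong (_⋆ q) (sym (ℕP.m≥n⇒m⊔n≡m b≤a)))

    0⊔[⋆-⋆] : ∀ a b → 0ℚ ⊔ (a ⋆ q - b ⋆ q) ≡ (a ∸ b) ⋆ q
    0⊔[⋆-⋆] a b with ℕP.≤-total b a
    ... | inj₁ b≤a = trans (cong (0ℚ ⊔_) (sym (⋆-homo-∸ q b≤a))) (p≤q⇒p⊔q≡q (⋆-nonNeg (a ∸ b)))
    ... | inj₂ a≤b = begin
      0ℚ ⊔ (a ⋆ q - b ⋆ q)          ≡⟨ cong (0ℚ ⊔_) (solve 2 (λ x y → x :- y := :- (y :- x)) refl (a ⋆ q) (b ⋆ q)) ⟩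
      0ℚ ⊔ - (b ⋆ q - a ⋆ q)        ≡⟨ cong (λ x → 0ℚ ⊔ - x) (sym (⋆-homo-∸ q a≤b)) ⟩
      0ℚ ⊔ - ((b ∸ a) ⋆ q)          ≡⟨ p≥q⇒p⊔q≡p (neg-antimono-≤ (⋆-nonNeg (b ∸ a))) ⟩
      0ℚ                            ≡⟨ sym (*-zeroˡ q) ⟩
      0 ⋆ q                         ≡⟨ cong (_⋆ q) (sym (ℕP.m≤n⇒m∸n≡0 a≤b)) ⟩
      (a ∸ b) ⋆ q                   ∎
      where open ≡-Reasoning

    ovl-⋆ : ∀ k a b → ovl (k ⋆ q) (a ⋆ q) (b ⋆ q) ≡ (b ∸ (a ℕ.⊔ k)) ⋆ q
    ovl-⋆ k a b = trans (cong (λ x → 0ℚ ⊔ (b ⋆ q - x)) (⋆-distrib-⊔ a k)) (0⊔[⋆-⋆] b (a ℕ.⊔ k))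

  -- Haar functions

  haarLo-⋆ : ∀ j M → haarLo j M ≡ (2 ℕ.* M) ⋆ 2^- suc j
  haarLo-⋆ j M = ⋆-refine M j

  haarMid-⋆ : ∀ j M → haarMid j M ≡ suc (2 ℕ.* M) ⋆ 2^- suc j
  haarMid-⋆ j M = cong (_⋆ 2^- suc j) (ℕP.+-comm (2 ℕ.* M) 1)

  haarHi-⋆ : ∀ j M → haarHi j M ≡ suc (suc (2 ℕ.* M)) ⋆ 2^- suc j
  haarHi-⋆ j M = trans (⋆-refine (suc M) j) (cong (_⋆ 2^- suc j) (ℕP.*-suc 2 M))

  tailInt-⋆ : ∀ {q} j M A X B → 0ℚ ≤ q →
              haarLo j M ≡ A ⋆ q → haarMid j M ≡ X ⋆ q → haarHi j M ≡ B ⋆ q → ∀ K →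
              tailInt j M (K ⋆ q) ≡ (X ∸ (A ℕ.⊔ K)) ⋆ q - (B ∸ (X ℕ.⊔ K)) ⋆ q
  tailInt-⋆ {q} j M A X B 0≤q lo mid hi K = begin
    ovl z (haarLo j M) (haarMid j M) - ovl z (haarMid j M) (haarHi j M)
      ≡⟨ cong₂ (λ l h → ovl z l (haarMid j M) - ovl z (haarMid j M) h) lo hi ⟩
    ovl z (A ⋆ q) (haarMid j M) - ovl z (haarMid j M) (B ⋆ q)
      ≡⟨ cong (λ c → ovl z (A ⋆ q) c - ovl z c (B ⋆ q)) mid ⟩
    ovl z (A ⋆ q) (X ⋆ q) - ovl z (X ⋆ q) (B ⋆ q)
      ≡⟨ cong₂ _-_ (ovl-⋆ 0≤q K A X) (ovl-⋆ 0≤q K X B) ⟩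
    (X ∸ (A ℕ.⊔ K)) ⋆ q - (B ∸ (X ℕ.⊔ K)) ⋆ q
      ∎
    where
    open ≡-Reasoning
    z = K ⋆ q

  tail-steps-midpoint : ∀ q L K →
    (suc L ∸ (L ℕ.⊔ K)) ⋆ q - (suc (suc L) ∸ (suc L ℕ.⊔ K)) ⋆ q ≡ (if does (K ℕP.≟ suc L) then - q else 0ℚ)
  tail-steps-midpoint q L K with ℕP.<-cmp K (suc L)
  ... | tri< (ℕ.s≤s K≤L) K≢1+L _ = begin
    (suc L ∸ (L ℕ.⊔ K)) ⋆ q - (suc (suc L) ∸ (suc L ℕ.⊔ K)) ⋆ q
      ≡⟨ cong₂ (λ u v → u ⋆ q - v ⋆ q)
               (trans (cong (suc L ∸_) (ℕP.m≥n⇒m⊔n≡m K≤L)) (ℕP.m+n∸n≡m 1 L))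
               (trans (cong (suc (suc L) ∸_) (ℕP.m≥n⇒m⊔n≡m (ℕP.m≤n⇒m≤1+n K≤L))) (ℕP.m+n∸n≡m 1 L)) ⟩
    1 ⋆ q - 1 ⋆ q                                ≡⟨ +-inverseʳ (1 ⋆ q) ⟩
    0ℚ                                           ≡⟨ cong (λ b → if b then - q else 0ℚ) (sym (dec-false (K ℕP.≟ suc L) K≢1+L)) ⟩
    (if does (K ℕP.≟ suc L) then - q else 0ℚ)    ∎
    where open ≡-Reasoning
  ... | tri≈ _ refl _ = begin
    (suc L ∸ (L ℕ.⊔ K)) ⋆ q - (suc (suc L) ∸ (suc L ℕ.⊔ K)) ⋆ q
      ≡⟨ cong₂ (λ u v → u ⋆ q - v ⋆ q)
               (trans (cong (suc L ∸_) (ℕP.m≤n⇒m⊔n≡n (ℕP.n≤1+n L))) (ℕP.n∸n≡0 (suc L)))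
               (trans (cong (suc (suc L) ∸_) (ℕP.⊔-idem (suc L))) (ℕP.m+n∸n≡m 1 L)) ⟩
    0 ⋆ q - 1 ⋆ q                                ≡⟨ solve 1 (λ q → con 0ℚ :* q :- con 1ℚ :* q := :- q) refl q ⟩
    - q                                          ≡⟨ cong (λ b → if b then - q else 0ℚ) (sym (dec-true (K ℕP.≟ K) refl)) ⟩
    (if does (K ℕP.≟ K) then - q else 0ℚ)        ∎
    where open ≡-Reasoning
  ... | tri> _ K≢1+L 1+L<K = begin
    (suc L ∸ (L ℕ.⊔ K)) ⋆ q - (suc (suc L) ∸ (suc L ℕ.⊔ K)) ⋆ q
      ≡⟨ cong₂ (λ u v → u ⋆ q - v ⋆ q)
               (trans (cong (suc L ∸_) (ℕP.m≤n⇒m⊔n≡n L≤K)) (ℕP.m≤n⇒m∸n≡0 1+L≤K))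
               (trans (cong (suc (suc L) ∸_) (ℕP.m≤n⇒m⊔n≡n 1+L≤K)) (ℕP.m≤n⇒m∸n≡0 1+L<K)) ⟩
    0 ⋆ q - 0 ⋆ q                                ≡⟨ +-inverseʳ (0 ⋆ q) ⟩
    0ℚ                                           ≡⟨ cong (λ b → if b then - q else 0ℚ) (sym (dec-false (K ℕP.≟ suc L) K≢1+L)) ⟩
    (if does (K ℕP.≟ suc L) then - q else 0ℚ)    ∎
    where
    open ≡-Reasoning
    1+L≤K = ℕP.<⇒≤ 1+L<K
    L≤K   = ℕP.≤-trans (ℕP.n≤1+n L) 1+L≤K

  tailInt-midpoint : ∀ j M K →
    tailInt j M (K ⋆ 2^- suc j) ≡ (if does (K ℕP.≟ suc (2 ℕ.* M)) then - 2^- suc j else 0ℚ)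
  tailInt-midpoint j M K = trans
    (tailInt-⋆ j M L (suc L) (suc (suc L)) (2^-nonNeg (suc j)) (haarLo-⋆ j M) (haarMid-⋆ j M) (haarHi-⋆ j M) K)
    (tail-steps-midpoint (2^- suc j) L K)
    where L = 2 ℕ.* M

  momentInt-≡ : ∀ j M → momentInt j M ≡ - (2^- suc j * 2^- suc j)
  momentInt-≡ j M = begin
    ½ * ((c * c - a * a) - (b * b - c * c))
      ≡⟨ cong₂ (λ a b → ½ * ((c * c - a * a) - (b * b - c * c))) (haarLo-⋆ j M) (haarHi-⋆ j M) ⟩
    ½ * ((c * c - L ⋆ q * L ⋆ q) - (suc (suc L) ⋆ q * suc (suc L) ⋆ q - c * c))
      ≡⟨ cong₂ (λ x y → ½ * ((x * q * (x * q) - L ⋆ q * L ⋆ q) - (y * q * (y * q) - x * q * (x * q))))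
               (ℕ→ℚ-homo-+ L 1) (trans (ℕ→ℚ-suc (suc L)) (cong (_+_ 1ℚ) (ℕ→ℚ-suc L))) ⟩
    ½ * (((x + 1ℚ) * q * ((x + 1ℚ) * q) - x * q * (x * q)) - ((1ℚ + (1ℚ + x)) * q * ((1ℚ + (1ℚ + x)) * q) - (x + 1ℚ) * q * ((x + 1ℚ) * q)))
      ≡⟨ solve 2 (λ x q → con ½ :* (((x :+ con 1ℚ) :* q :* ((x :+ con 1ℚ) :* q) :- x :* q :* (x :* q))
                            :- ((con 1ℚ :+ (con 1ℚ :+ x)) :* q :* ((con 1ℚ :+ (con 1ℚ :+ x)) :* q) :- (x :+ con 1ℚ) :* q :* ((x :+ con 1ℚ) :* q)))
                          := :- (q :* q)) refl x q ⟩
    - (q * q) ∎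
    where
    open ≡-Reasoning
    q = 2^- suc j
    L = 2 ℕ.* M
    x = ℕ→ℚ L
    a = haarLo j M
    b = haarHi j M
    c = haarMid j M

  module _ (m : ℕ) where

    private
      q = 2^- suc m

    tailInt-00-⋆ : ∀ K → tailInt 0 0 (K ⋆ q) ≡ (2 ^ m ∸ K) ⋆ q - (2 ^ suc m ∸ (2 ^ m ℕ.⊔ K)) ⋆ q
    tailInt-00-⋆ = tailInt-⋆ 0 0 0 (2 ^ m) (2 ^ suc m) (2^-nonNeg (suc m))
      (sym (*-zeroˡ q)) (sym (2^m⋆2^-[1+m]≡½ m)) (sym (trans (*-comm (ℕ→ℚ (2 ^ suc m)) q) (2^-k*2^k≡1 (suc m))))

    tailInt-00-lower : ∀ {V} → V ℕ.≤ 2 ^ m → tailInt 0 0 (V ⋆ q) ≡ - (V ⋆ q)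
    tailInt-00-lower {V} V≤2^m = begin
      tailInt 0 0 (V ⋆ q)                                    ≡⟨ tailInt-00-⋆ V ⟩
      (2 ^ m ∸ V) ⋆ q - (2 ^ suc m ∸ (2 ^ m ℕ.⊔ V)) ⋆ q      ≡⟨ cong₂ (λ u v → u - v ⋆ q) (⋆-homo-∸ q V≤2^m) upper-half ⟩
      (2 ^ m ⋆ q - V ⋆ q) - 2 ^ m ⋆ q                        ≡⟨ solve 2 (λ h x → (h :- x) :- h := :- x) refl (2 ^ m ⋆ q) (V ⋆ q) ⟩
      - (V ⋆ q)                                              ∎
      where
      open ≡-Reasoning
      upper-half : 2 ^ suc m ∸ (2 ^ m ℕ.⊔ V) ≡ 2 ^ m
      upper-half = trans (cong (2 ^ suc m ∸_) (ℕP.m≥n⇒m⊔n≡m V≤2^m))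
                         (trans (ℕP.m+n∸m≡n (2 ^ m) (2 ^ m ℕ.+ 0)) (ℕP.+-identityʳ (2 ^ m)))

    tailInt-00-upper : ∀ {V} → V ℕ.≤ 2 ^ m → tailInt 0 0 ((2 ^ m ℕ.+ V) ⋆ q) ≡ V ⋆ q - ½
    tailInt-00-upper {V} V≤2^m = begin
      tailInt 0 0 (K ⋆ q)                                    ≡⟨ tailInt-00-⋆ K ⟩
      (2 ^ m ∸ K) ⋆ q - (2 ^ suc m ∸ (2 ^ m ℕ.⊔ K)) ⋆ q      ≡⟨ cong₂ (λ u v → u ⋆ q - v ⋆ q) lower-half upper-half ⟩
      0 ⋆ q - (2 ^ m ∸ V) ⋆ q                                ≡⟨ cong (_-_ (0 ⋆ q)) (⋆-homo-∸ q V≤2^m) ⟩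
      0 ⋆ q - (2 ^ m ⋆ q - V ⋆ q)                            ≡⟨ cong (λ h → 0 ⋆ q - (h - V ⋆ q)) (2^m⋆2^-[1+m]≡½ m) ⟩
      0 ⋆ q - (½ - V ⋆ q)                                    ≡⟨ solve 2 (λ q x → con 0ℚ :* q :- (con ½ :- x) := x :- con ½) refl q (V ⋆ q) ⟩
      V ⋆ q - ½                                              ∎
      where
      open ≡-Reasoning
      K = 2 ^ m ℕ.+ V
      lower-half : 2 ^ m ∸ K ≡ 0
      lower-half = ℕP.m≤n⇒m∸n≡0 (ℕP.m≤m+n (2 ^ m) V)
      upper-half : 2 ^ suc m ∸ (2 ^ m ℕ.⊔ K) ≡ 2 ^ m ∸ V
      upper-half = trans (cong (2 ^ suc m ∸_) (ℕP.m≤n⇒m⊔n≡n (ℕP.m≤m+n (2 ^ m) V)))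
                         (trans (ℕP.[m+n]∸[m+o]≡n∸o (2 ^ m) (2 ^ m ℕ.+ 0) V) (cong (_∸ V) (ℕP.+-identityʳ (2 ^ m))))

  -- Binary digits

  bits→ℕ : ∀ {k} → Vec Bool k → ℕ
  bits→ℕ []                 = 0
  bits→ℕ (false ∷ v)        = bits→ℕ v
  bits→ℕ {suc k} (true ∷ v) = 2 ^ k ℕ.+ bits→ℕ v

  bits→ℕ<2^k : ∀ {k} (v : Vec Bool k) → bits→ℕ v ℕ.< 2 ^ k
  bits→ℕ<2^k []                 = ℕ.s≤s ℕ.z≤n
  bits→ℕ<2^k {suc k} (false ∷ v) = ℕP.<-≤-trans (bits→ℕ<2^k v) (ℕP.m≤m+n (2 ^ k) (2 ^ k ℕ.+ 0))
  bits→ℕ<2^k {suc k} (true ∷ v)  = ℕP.+-monoʳ-< (2 ^ k) (ℕP.<-≤-trans (bits→ℕ<2^k v) (ℕP.m≤m+n (2 ^ k) 0))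

  bits→ℕ-injective : ∀ {k} {u v : Vec Bool k} → bits→ℕ u ≡ bits→ℕ v → u ≡ v
  bits→ℕ-injective {u = []}      {[]}      _  = refl
  bits→ℕ-injective {u = false ∷ u} {false ∷ v} eq = cong (false ∷_) (bits→ℕ-injective eq)
  bits→ℕ-injective {suc k} {true ∷ u} {true ∷ v} eq = cong (true ∷_) (bits→ℕ-injective (ℕP.+-cancelˡ-≡ (2 ^ k) _ _ eq))
  bits→ℕ-injective {suc k} {false ∷ u} {true ∷ v} eq =
    ⊥-elim (ℕP.m+n≮m (2 ^ k) (bits→ℕ v) (subst (ℕ._< 2 ^ k) eq (bits→ℕ<2^k u)))
  bits→ℕ-injective {suc k} {true ∷ u} {false ∷ v} eq =
    ⊥-elim (ℕP.m+n≮m (2 ^ k) (bits→ℕ u) (subst (ℕ._< 2 ^ k) (sym eq) (bits→ℕ<2^k v)))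

  bits→ℕ-∷ʳ : ∀ {k} (v : Vec Bool k) y → bits→ℕ (v ∷ʳ y) ≡ bits→ℕ (y ∷ []) ℕ.+ 2 ℕ.* bits→ℕ v
  bits→ℕ-∷ʳ []          y = sym (ℕP.+-identityʳ (bits→ℕ (y ∷ [])))
  bits→ℕ-∷ʳ (false ∷ v) y = bits→ℕ-∷ʳ v y
  bits→ℕ-∷ʳ {suc k} (true ∷ v) y = begin
    2 ^ suc k ℕ.+ bits→ℕ (v ∷ʳ y)                  ≡⟨ cong (2 ^ suc k ℕ.+_) (bits→ℕ-∷ʳ v y) ⟩
    2 ℕ.* 2 ^ k ℕ.+ (b ℕ.+ 2 ℕ.* bits→ℕ v)          ≡⟨ regroup (2 ^ k) b (bits→ℕ v) ⟩
    b ℕ.+ 2 ℕ.* (2 ^ k ℕ.+ bits→ℕ v)                ∎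
    where
    open ≡-Reasoning
    b = bits→ℕ (y ∷ [])
    regroup : ∀ p b v → 2 ℕ.* p ℕ.+ (b ℕ.+ 2 ℕ.* v) ≡ b ℕ.+ 2 ℕ.* (p ℕ.+ v)
    regroup = solve-∀

  binFrac-bits→ℕ : ∀ {k} (v : Vec Bool k) → binFrac v ≡ bits→ℕ v ⋆ 2^- k
  binFrac-bits→ℕ []          = refl
  binFrac-bits→ℕ {suc k} (false ∷ v) = begin
    ½ * (0ℚ + binFrac v)                 ≡⟨ cong (λ x → ½ * (0ℚ + x)) (binFrac-bits→ℕ v) ⟩
    ½ * (0ℚ + ℕ→ℚ (bits→ℕ v) * 2^- k)    ≡⟨ solve 2 (λ x p → con ½ :* (con 0ℚ :+ x :* p) := x :* (con ½ :* p)) refl (ℕ→ℚ (bits→ℕ v)) (2^- k) ⟩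
    ℕ→ℚ (bits→ℕ v) * (½ * 2^- k)         ≡⟨ cong (ℕ→ℚ (bits→ℕ v) *_) (sym (2^-‿+ 1 k)) ⟩
    ℕ→ℚ (bits→ℕ v) * 2^- suc k           ∎
    where open ≡-Reasoning
  binFrac-bits→ℕ {suc k} (true ∷ v) = begin
    ½ * (1ℚ + binFrac v)                          ≡⟨ cong₂ (λ o x → ½ * (o + x)) (sym (2^-k*2^k≡1 k)) (binFrac-bits→ℕ v) ⟩
    ½ * (2^- k * N + V * 2^- k)                   ≡⟨ solve 3 (λ p n x → con ½ :* (p :* n :+ x :* p) := (n :+ x) :* (con ½ :* p)) refl (2^- k) N V ⟩
    (N + V) * (½ * 2^- k)                         ≡⟨ cong₂ _*_ (sym (ℕ→ℚ-homo-+ (2 ^ k) (bits→ℕ v))) (sym (2^-‿+ 1 k)) ⟩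
    ℕ→ℚ (2 ^ k ℕ.+ bits→ℕ v) * 2^- suc k          ∎
    where
    open ≡-Reasoning
    N = ℕ→ℚ (2 ^ k)
    V = ℕ→ℚ (bits→ℕ v)

  applyUpTo-+ : ∀ {A : Set} (f : ℕ → A) a b → applyUpTo f (a ℕ.+ b) ≡ applyUpTo f a ++ applyUpTo (f ∘ (a ℕ.+_)) b
  applyUpTo-+ f zero    b = refl
  applyUpTo-+ f (suc a) b = cong (f 0 ∷_) (applyUpTo-+ (f ∘ suc) a b)

  map-bits→ℕ-allVecs : ∀ k → map bits→ℕ (allVecs k) ≡ upTo (2 ^ k)
  map-bits→ℕ-allVecs zero    = refl
  map-bits→ℕ-allVecs (suc k) = begin
    map bits→ℕ (map (false ∷_) A ++ map (true ∷_) A)          ≡⟨ ListP.map-++ bits→ℕ (map (false ∷_) A) (map (true ∷_) A) ⟩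
    map bits→ℕ (map (false ∷_) A) ++ map bits→ℕ (map (true ∷_) A)
      ≡⟨ cong₂ _++_ (sym (ListP.map-∘ A)) (trans (sym (ListP.map-∘ A)) (ListP.map-∘ A)) ⟩
    map bits→ℕ A ++ map (2 ^ k ℕ.+_) (map bits→ℕ A)          ≡⟨ cong (λ l → l ++ map (2 ^ k ℕ.+_) l) (map-bits→ℕ-allVecs k) ⟩
    upTo (2 ^ k) ++ map (2 ^ k ℕ.+_) (upTo (2 ^ k))          ≡⟨ cong (upTo (2 ^ k) ++_) (ListP.map-upTo (2 ^ k ℕ.+_) (2 ^ k)) ⟩
    upTo (2 ^ k) ++ applyUpTo (2 ^ k ℕ.+_) (2 ^ k)           ≡⟨ sym (applyUpTo-+ id (2 ^ k) (2 ^ k)) ⟩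
    upTo (2 ^ k ℕ.+ 2 ^ k)                                   ≡⟨ cong (λ n → upTo (2 ^ k ℕ.+ n)) (sym (ℕP.+-identityʳ (2 ^ k))) ⟩
    upTo (2 ^ suc k)                                         ∎
    where
    open ≡-Reasoning
    A = allVecs k

  length-allVecs : ∀ k → length (allVecs k) ≡ 2 ^ k
  length-allVecs k = begin
    length (allVecs k)             ≡⟨ sym (ListP.length-map bits→ℕ (allVecs k)) ⟩
    length (map bits→ℕ (allVecs k)) ≡⟨ cong length (map-bits→ℕ-allVecs k) ⟩
    length (upTo (2 ^ k))           ≡⟨ ListP.length-upTo (2 ^ k) ⟩
    2 ^ k                           ∎
    where open ≡-Reasoning

  rev-∷ʳ : ∀ {k} (u : Vec Bool k) x → rev (u ∷ʳ x) ≡ x ∷ rev u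
  rev-∷ʳ []      x = refl
  rev-∷ʳ (y ∷ u) x = cong (_∷ʳ y) (rev-∷ʳ u x)

  infixl 6 _⊕_
  _⊕_ : ∀ {k} → Vec Bool k → Vec Bool k → Vec Bool k
  _⊕_ = zipWith _xor_

  ⊕-cancelʳ : ∀ {k} (u c : Vec Bool k) → u ⊕ c ⊕ c ≡ u
  ⊕-cancelʳ []      []      = refl
  ⊕-cancelʳ (x ∷ u) (y ∷ c) =
    cong₂ _∷_ (trans (BoolP.xor-assoc x y y) (trans (cong (x xor_) (BoolP.xor-same y)) (BoolP.xor-identityʳ x))) (⊕-cancelʳ u c)

  infix 4 _≟ᵛ_
  _≟ᵛ_ : ∀ {k} → DecidableEquality (Vec Bool k)
  _≟ᵛ_ = VecP.≡-dec BoolP._≟_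

  tailInt-binFrac-∷ʳ : ∀ {m} (v w : Vec Bool m) y →
    tailInt m (bits→ℕ w) (binFrac (v ∷ʳ y)) ≡ (if y ∧ does (v ≟ᵛ w) then - 2^- suc m else 0ℚ)
  tailInt-binFrac-∷ʳ {m} v w y = begin
    tailInt m W (binFrac (v ∷ʳ y))                          ≡⟨ cong (tailInt m W) (binFrac-bits→ℕ (v ∷ʳ y)) ⟩
    tailInt m W (bits→ℕ (v ∷ʳ y) ⋆ 2^- suc m)               ≡⟨ tailInt-midpoint m W (bits→ℕ (v ∷ʳ y)) ⟩
    (if does (bits→ℕ (v ∷ʳ y) ℕP.≟ suc (2 ℕ.* W)) then - 2^- suc m else 0ℚ)
      ≡⟨ cong (λ b → if b then - 2^- suc m else 0ℚ) (midpoint-digits y) ⟩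
    (if y ∧ does (v ≟ᵛ w) then - 2^- suc m else 0ℚ)         ∎
    where
    open ≡-Reasoning
    W = bits→ℕ w
    digits : ∀ {y} → bits→ℕ (v ∷ʳ y) ≡ suc (2 ℕ.* W) → v ≡ w × y ≡ true
    digits eq = VecP.∷ʳ-injective v w (bits→ℕ-injective (trans eq (sym (bits→ℕ-∷ʳ w true))))
    midpoint-digits : ∀ y → does (bits→ℕ (v ∷ʳ y) ℕP.≟ suc (2 ℕ.* W)) ≡ y ∧ does (v ≟ᵛ w)
    midpoint-digits true  = does-⇔ (mk⇔ (proj₁ ∘ digits) (λ { refl → bits→ℕ-∷ʳ v true })) (_ ℕP.≟ _) (v ≟ᵛ w)
    midpoint-digits false = dec-false (_ ℕP.≟ _) (λ eq → false≢true (proj₂ (digits eq)))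
      where
      false≢true : false ≢ true
      false≢true ()

  -- c is μ_{(0,m),(0,M)} when the only contributing point has x-coordinate binFrac (s ∷ v).
  midpointCoeff-square : ∀ {m} M s (v : Vec Bool m) →
    let q = 2^- suc m
        c = q * (tailInt 0 0 (binFrac (s ∷ v)) * - q) - momentInt 0 0 * momentInt m M
        V = bits→ℕ v in
    c * c ≡ q * q * (q * q) * ((V ⋆ q - ¼) * (V ⋆ q - ¼))
  midpointCoeff-square {m} M s v = begin
    c (tailInt 0 0 (binFrac (s ∷ v))) * c (tailInt 0 0 (binFrac (s ∷ v)))
      ≡⟨ cong (λ t → c t * c t) (cong (tailInt 0 0) (binFrac-bits→ℕ (s ∷ v))) ⟩
    c (tailInt 0 0 (bits→ℕ (s ∷ v) ⋆ q)) * c (tailInt 0 0 (bits→ℕ (s ∷ v) ⋆ q))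
      ≡⟨ cong (λ μ → (q * (tailInt 0 0 (bits→ℕ (s ∷ v) ⋆ q) * - q) - μ) * (q * (tailInt 0 0 (bits→ℕ (s ∷ v) ⋆ q) * - q) - μ)) moments ⟩
    c′ (tailInt 0 0 (bits→ℕ (s ∷ v) ⋆ q)) * c′ (tailInt 0 0 (bits→ℕ (s ∷ v) ⋆ q))
      ≡⟨ by-half s ⟩
    q * q * (q * q) * ((V ⋆ q - ¼) * (V ⋆ q - ¼)) ∎
    where
    open ≡-Reasoning
    q = 2^- suc m
    V = bits→ℕ v
    c c′ : ℚ → ℚ
    c  t = q * (t * - q) - momentInt 0 0 * momentInt m M
    c′ t = q * (t * - q) - ¼ * (q * q)
    moments : momentInt 0 0 * momentInt m M ≡ ¼ * (q * q)
    moments = trans (cong₂ _*_ (momentInt-≡ 0 0) (momentInt-≡ m M))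
                    (solve 1 (λ q → :- (con ½ :* con ½) :* :- (q :* q) := con ¼ :* (q :* q)) refl q)
    -- On the upper half of [0, 1) the tail integral at x is x - 1 rather than -x; the sign dies in the square.
    by-half : ∀ s → c′ (tailInt 0 0 (bits→ℕ (s ∷ v) ⋆ q)) * c′ (tailInt 0 0 (bits→ℕ (s ∷ v) ⋆ q))
                    ≡ q * q * (q * q) * ((V ⋆ q - ¼) * (V ⋆ q - ¼))
    by-half false = trans (cong (λ t → c′ t * c′ t) (tailInt-00-lower m (ℕP.<⇒≤ (bits→ℕ<2^k v))))
      (solve 2 (λ x q → (q :* (:- x :* :- q) :- con ¼ :* (q :* q)) :* (q :* (:- x :* :- q) :- con ¼ :* (q :* q))
                        := q :* q :* (q :* q) :* ((x :- con ¼) :* (x :- con ¼))) refl (V ⋆ q) q)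
    by-half true  = trans (cong (λ t → c′ t * c′ t) (tailInt-00-upper m (ℕP.<⇒≤ (bits→ℕ<2^k v))))
      (solve 2 (λ x q → (q :* ((x :- con ½) :* :- q) :- con ¼ :* (q :* q)) :* (q :* ((x :- con ½) :* :- q) :- con ¼ :* (q :* q))
                        := q :* q :* (q :* q) :* ((x :- con ¼) :* (x :- con ¼))) refl (V ⋆ q) q)

  -- Finite sums

  sumℚ-++ : ∀ xs ys → sumℚ (xs ++ ys) ≡ sumℚ xs + sumℚ ys
  sumℚ-++ []       ys = sym (+-identityˡ (sumℚ ys))
  sumℚ-++ (x ∷ xs) ys = trans (cong (x +_) (sumℚ-++ xs ys)) (sym (+-assoc x (sumℚ xs) (sumℚ ys)))

  module _ {A : Set} where

    sumℚ-map-0 : ∀ (xs : List A) → sumℚ (map (λ _ → 0ℚ) xs) ≡ 0ℚ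
    sumℚ-map-0 []       = refl
    sumℚ-map-0 (x ∷ xs) = trans (+-identityˡ _) (sumℚ-map-0 xs)

    sumℚ-map-*ˡ : ∀ c (f : A → ℚ) xs → sumℚ (map (λ x → c * f x) xs) ≡ c * sumℚ (map f xs)
    sumℚ-map-*ˡ c f []       = sym (*-zeroʳ c)
    sumℚ-map-*ˡ c f (x ∷ xs) = trans (cong (c * f x +_) (sumℚ-map-*ˡ c f xs)) (sym (*-distribˡ-+ c (f x) _))

  sumℚ-upTo-suc : ∀ (f : ℕ → ℚ) N → sumℚ (map f (upTo (suc N))) ≡ sumℚ (map f (upTo N)) + f N
  sumℚ-upTo-suc f N = begin
    sumℚ (map f (upTo (suc N)))               ≡⟨ cong (sumℚ ∘ map f) (sym (ListP.upTo-∷ʳ N)) ⟩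
    sumℚ (map f (upTo N ++ [ N ]))            ≡⟨ cong sumℚ (ListP.map-++ f (upTo N) [ N ]) ⟩
    sumℚ (map f (upTo N) ++ [ f N ])          ≡⟨ sumℚ-++ (map f (upTo N)) [ f N ] ⟩
    sumℚ (map f (upTo N)) + (f N + 0ℚ)        ≡⟨ cong (sumℚ (map f (upTo N)) +_) (+-identityʳ (f N)) ⟩
    sumℚ (map f (upTo N)) + f N               ∎
    where open ≡-Reasoning

  -- q Σ_{i < L/q} (i q - c)²: the left Riemann sum of (x - c)² on [0, L] with mesh q.
  riemannSquare : ℚ → ℚ → ℚ → ℚ
  riemannSquare L q c = L * (L - q) * (L + L - q) * (ℤ.+ 1 / 6) - c * L * (L - q) + L * c * c

  *-sumℚ-square : ∀ q c N →
    q * sumℚ (map (λ i → (i ⋆ q - c) * (i ⋆ q - c)) (upTo N)) ≡ riemannSquare (N ⋆ q) q c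
  *-sumℚ-square q c zero = solve 2 (λ q c → q :* con 0ℚ := con 0ℚ :* q :* (con 0ℚ :* q :- q) :* (con 0ℚ :* q :+ con 0ℚ :* q :- q) :* con (ℤ.+ 1 / 6)
                                                    :- c :* (con 0ℚ :* q) :* (con 0ℚ :* q :- q) :+ con 0ℚ :* q :* c :* c) refl q c
  *-sumℚ-square q c (suc N) = begin
    q * sumℚ (map f (upTo (suc N)))         ≡⟨ cong (q *_) (sumℚ-upTo-suc f N) ⟩
    q * (sumℚ (map f (upTo N)) + f N)       ≡⟨ *-distribˡ-+ q _ (f N) ⟩
    q * sumℚ (map f (upTo N)) + q * f N     ≡⟨ cong (_+ q * f N) (*-sumℚ-square q c N) ⟩
    riemannSquare (x * q) q c + q * ((x * q - c) * (x * q - c))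
      ≡⟨ solve 3 (λ x q c → let L = x :* q ; L′ = (con 1ℚ :+ x) :* q in
                   L :* (L :- q) :* (L :+ L :- q) :* con (ℤ.+ 1 / 6) :- c :* L :* (L :- q) :+ L :* c :* c :+ q :* ((L :- c) :* (L :- c))
                   := L′ :* (L′ :- q) :* (L′ :+ L′ :- q) :* con (ℤ.+ 1 / 6) :- c :* L′ :* (L′ :- q) :+ L′ :* c :* c) refl x q c ⟩
    riemannSquare ((1ℚ + x) * q) q c        ≡⟨ cong (λ y → riemannSquare (y * q) q c) (sym (ℕ→ℚ-suc N)) ⟩
    riemannSquare (suc N ⋆ q) q c           ∎
    where
    open ≡-Reasoning
    f = λ i → (i ⋆ q - c) * (i ⋆ q - c)
    x = ℕ→ℚ N

  sumVecs : ∀ k → (Vec Bool k → ℚ) → ℚ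
  sumVecs k f = sumℚ (map f (allVecs k))

  sumVecs-cong : ∀ k {f g : Vec Bool k → ℚ} → (∀ v → f v ≡ g v) → sumVecs k f ≡ sumVecs k g
  sumVecs-cong k f≗g = cong sumℚ (ListP.map-cong f≗g (allVecs k))

  sumVecs-∷ : ∀ k (f : Vec Bool (suc k) → ℚ) → sumVecs (suc k) f ≡ sumVecs k (f ∘ (false ∷_)) + sumVecs k (f ∘ (true ∷_))
  sumVecs-∷ k f = begin
    sumℚ (map f (map (false ∷_) A ++ map (true ∷_) A))                ≡⟨ cong sumℚ (ListP.map-++ f (map (false ∷_) A) (map (true ∷_) A)) ⟩
    sumℚ (map f (map (false ∷_) A) ++ map f (map (true ∷_) A))        ≡⟨ sumℚ-++ (map f (map (false ∷_) A)) (map f (map (true ∷_) A)) ⟩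
    sumℚ (map f (map (false ∷_) A)) + sumℚ (map f (map (true ∷_) A))  ≡⟨ sym (cong₂ _+_ (cong sumℚ (ListP.map-∘ A)) (cong sumℚ (ListP.map-∘ A))) ⟩
    sumVecs k (f ∘ (false ∷_)) + sumVecs k (f ∘ (true ∷_))            ∎
    where
    open ≡-Reasoning
    A = allVecs k

  sumVecs-∷ʳ : ∀ k (f : Vec Bool (suc k) → ℚ) → sumVecs (suc k) f ≡ sumVecs k (f ∘ (_∷ʳ false)) + sumVecs k (f ∘ (_∷ʳ true))
  sumVecs-∷ʳ zero    f = solve 2 (λ a b → a :+ (b :+ con 0ℚ) := (a :+ con 0ℚ) :+ (b :+ con 0ℚ)) refl (f (false ∷ [])) (f (true ∷ []))
  sumVecs-∷ʳ (suc k) f = begin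
    sumVecs (suc (suc k)) f                                                     ≡⟨ sumVecs-∷ (suc k) f ⟩
    sumVecs (suc k) (f ∘ (false ∷_)) + sumVecs (suc k) (f ∘ (true ∷_))          ≡⟨ cong₂ _+_ (sumVecs-∷ʳ k (f ∘ (false ∷_))) (sumVecs-∷ʳ k (f ∘ (true ∷_))) ⟩
    (ff + ft) + (tf + tt)                                                       ≡⟨ solve 4 (λ a b c d → (a :+ b) :+ (c :+ d) := (a :+ c) :+ (b :+ d)) refl ff ft tf tt ⟩
    (ff + tf) + (ft + tt)                                                       ≡⟨ sym (cong₂ _+_ (sumVecs-∷ k (f ∘ (_∷ʳ false))) (sumVecs-∷ k (f ∘ (_∷ʳ true)))) ⟩
    sumVecs (suc k) (f ∘ (_∷ʳ false)) + sumVecs (suc k) (f ∘ (_∷ʳ true))        ∎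
    where
    open ≡-Reasoning
    ff = sumVecs k (λ u → f (false ∷ (u ∷ʳ false)))
    ft = sumVecs k (λ u → f (false ∷ (u ∷ʳ true)))
    tf = sumVecs k (λ u → f (true ∷ (u ∷ʳ false)))
    tt = sumVecs k (λ u → f (true ∷ (u ∷ʳ true)))

  sumVecs-rev : ∀ k (f : Vec Bool k → ℚ) → sumVecs k (f ∘ rev) ≡ sumVecs k f
  sumVecs-rev zero    f = refl
  sumVecs-rev (suc k) f = begin
    sumVecs (suc k) (f ∘ rev)                                               ≡⟨ sumVecs-∷ k (f ∘ rev) ⟩
    sumVecs k (λ v → f (rev v ∷ʳ false)) + sumVecs k (λ v → f (rev v ∷ʳ true)) ≡⟨ cong₂ _+_ (sumVecs-rev k (f ∘ (_∷ʳ false))) (sumVecs-rev k (f ∘ (_∷ʳ true))) ⟩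
    sumVecs k (f ∘ (_∷ʳ false)) + sumVecs k (f ∘ (_∷ʳ true))                ≡⟨ sym (sumVecs-∷ʳ k f) ⟩
    sumVecs (suc k) f                                                       ∎
    where open ≡-Reasoning

  sumVecs-⊕ : ∀ k (c : Vec Bool k) (f : Vec Bool k → ℚ) → sumVecs k (λ u → f (u ⊕ c)) ≡ sumVecs k f
  sumVecs-⊕ zero    []      f = refl
  sumVecs-⊕ (suc k) (y ∷ c) f = begin
    sumVecs (suc k) (λ u → f (u ⊕ (y ∷ c)))                   ≡⟨ sumVecs-∷ k (λ u → f (u ⊕ (y ∷ c))) ⟩
    S (λ v → f ((false xor y) ∷ v ⊕ c)) + S (λ v → f ((true xor y) ∷ v ⊕ c))
      ≡⟨ cong₂ _+_ (sumVecs-⊕ k c (f ∘ ((false xor y) ∷_))) (sumVecs-⊕ k c (f ∘ ((true xor y) ∷_))) ⟩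
    S (f ∘ ((false xor y) ∷_)) + S (f ∘ ((true xor y) ∷_))    ≡⟨ swap y ⟩
    S (f ∘ (false ∷_)) + S (f ∘ (true ∷_))                    ≡⟨ sym (sumVecs-∷ k f) ⟩
    sumVecs (suc k) f                                         ∎
    where
    open ≡-Reasoning
    S = sumVecs k
    swap : ∀ y → S (f ∘ ((false xor y) ∷_)) + S (f ∘ ((true xor y) ∷_)) ≡ S (f ∘ (false ∷_)) + S (f ∘ (true ∷_))
    swap false = refl
    swap true  = +-comm (S (f ∘ (true ∷_))) (S (f ∘ (false ∷_)))

  sumVecs-indicator : ∀ k (w : Vec Bool k) (f : Vec Bool k → ℚ) →
    sumVecs k (λ u → if does (u ≟ᵛ w) then f u else 0ℚ) ≡ f w
  sumVecs-indicator zero    []          f = +-identityʳ (f [])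
  sumVecs-indicator (suc k) (false ∷ w) f = begin
    sumVecs (suc k) (λ u → if does (u ≟ᵛ (false ∷ w)) then f u else 0ℚ)   ≡⟨ sumVecs-∷ k _ ⟩
    S (λ v → if does (v ≟ᵛ w) then f (false ∷ v) else 0ℚ) + S (λ _ → 0ℚ)  ≡⟨ cong₂ _+_ (sumVecs-indicator k w (f ∘ (false ∷_))) (sumℚ-map-0 (allVecs k)) ⟩
    f (false ∷ w) + 0ℚ                                                    ≡⟨ +-identityʳ _ ⟩
    f (false ∷ w)                                                         ∎
    where
    open ≡-Reasoning
    S = sumVecs k
  sumVecs-indicator (suc k) (true ∷ w)  f = begin
    sumVecs (suc k) (λ u → if does (u ≟ᵛ (true ∷ w)) then f u else 0ℚ)    ≡⟨ sumVecs-∷ k _ ⟩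
    S (λ _ → 0ℚ) + S (λ v → if does (v ≟ᵛ w) then f (true ∷ v) else 0ℚ)   ≡⟨ cong₂ _+_ (sumℚ-map-0 (allVecs k)) (sumVecs-indicator k w (f ∘ (true ∷_))) ⟩
    0ℚ + f (true ∷ w)                                                     ≡⟨ +-identityˡ _ ⟩
    f (true ∷ w)                                                          ∎
    where
    open ≡-Reasoning
    S = sumVecs k

  sumVecs-select : ∀ k (w : Vec Bool k) b c (f : Vec Bool k → ℚ) →
    sumVecs k (λ u → f u * (if b ∧ does (u ≟ᵛ w) then c else 0ℚ)) ≡ (if b then f w * c else 0ℚ)
  sumVecs-select k w false c f = trans (sumVecs-cong k (λ u → *-zeroʳ (f u))) (sumℚ-map-0 (allVecs k))
  sumVecs-select k w true  c f = trans (sumVecs-cong k (λ u → *-if (f u) (does (u ≟ᵛ w)))) (sumVecs-indicator k w (λ u → f u * c))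
    where
    *-if : ∀ x b → x * (if b then c else 0ℚ) ≡ (if b then x * c else 0ℚ)
    *-if x true  = refl
    *-if x false = *-zeroʳ x

  sumVecs-bits→ℕ : ∀ k (f : ℕ → ℚ) → sumVecs k (f ∘ bits→ℕ) ≡ sumℚ (map f (upTo (2 ^ k)))
  sumVecs-bits→ℕ k f = trans (cong sumℚ (ListP.map-∘ (allVecs k))) (cong (sumℚ ∘ map f) (map-bits→ℕ-allVecs k))

  -- The point set P_a(σ)

  module PointSet {m} (a : Vec Bool m) (σ : Vec Bool (suc m)) where

    private
      q = 2^- suc m
      P = pointSet (suc m) a σ

    shift : Bool → Vec Bool m
    shift x = zipWith _∧_ a (replicate m x)

    ydigits ydigits⁻¹ : Bool → Vec Bool m → Vec Bool m
    ydigits   x u = u ⊕ shift x ⊕ init σ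
    ydigits⁻¹ x w = w ⊕ init σ ⊕ shift x

    point-∷ʳ : ∀ u x → point a σ (u ∷ʳ x) ≡ (binFrac (x ∷ rev u) , binFrac (ydigits x u ∷ʳ (x xor last σ)))
    point-∷ʳ u x = begin
      point a σ (u ∷ʳ x)
        ≡⟨ cong₂ (λ i l → binFrac (rev (u ∷ʳ x)) , binFrac (i ⊕ shift l ⊕ init σ ∷ʳ (l xor last σ))) (VecP.init-∷ʳ x u) (VecP.last-∷ʳ x u) ⟩
      (binFrac (rev (u ∷ʳ x)) , binFrac (ydigits x u ∷ʳ (x xor last σ)))
        ≡⟨ cong (λ r → binFrac r , binFrac (ydigits x u ∷ʳ (x xor last σ))) (rev-∷ʳ u x) ⟩
      (binFrac (x ∷ rev u) , binFrac (ydigits x u ∷ʳ (x xor last σ))) ∎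
      where open ≡-Reasoning

    does-ydigits : ∀ x u w → does (ydigits x u ≟ᵛ w) ≡ does (u ≟ᵛ ydigits⁻¹ x w)
    does-ydigits x u w = trans (does-⇔ (⊕-⇔ (u ⊕ shift x) (init σ) w) (ydigits x u ≟ᵛ w) (u ⊕ shift x ≟ᵛ w ⊕ init σ))
                               (does-⇔ (⊕-⇔ u (shift x) (w ⊕ init σ)) (u ⊕ shift x ≟ᵛ w ⊕ init σ) (u ≟ᵛ ydigits⁻¹ x w))
      where
      ⊕-⇔ : ∀ (u c w : Vec Bool m) → (u ⊕ c ≡ w) ⇔ (u ≡ w ⊕ c)
      ⊕-⇔ u c w = mk⇔ (λ { refl → sym (⊕-cancelʳ u c) }) (λ { refl → ⊕-cancelʳ w c })

    sumVecs-ydigits⁻¹ : ∀ x (f : Vec Bool m → ℚ) → sumVecs m (f ∘ ydigits⁻¹ x) ≡ sumVecs m f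
    sumVecs-ydigits⁻¹ x f = trans (sumVecs-⊕ m (init σ) (λ u → f (u ⊕ shift x))) (sumVecs-⊕ m (shift x) f)

    -- Only the point t = ydigits⁻¹ (not σₙ) w ∷ʳ not σₙ has its y-coordinate at the midpoint of the support of
    -- h_{m, bits→ℕ w}, so it is the only one contributing.
    sum-tailProducts : ∀ w →
      sumℚ (map (λ z → tailInt 0 0 (proj₁ z) * tailInt m (bits→ℕ w) (proj₂ z)) P)
        ≡ tailInt 0 0 (binFrac (not (last σ) ∷ rev (ydigits⁻¹ (not (last σ)) w))) * - q
    sum-tailProducts w = begin
      sumℚ (map h (map (point a σ) (allVecs (suc m))))                ≡⟨ cong sumℚ (sym (ListP.map-∘ (allVecs (suc m)))) ⟩
      sumVecs (suc m) (h ∘ point a σ)                                 ≡⟨ sumVecs-∷ʳ m (h ∘ point a σ) ⟩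
      sumVecs m (h ∘ point a σ ∘ (_∷ʳ false)) + sumVecs m (h ∘ point a σ ∘ (_∷ʳ true))
        ≡⟨ cong₂ _+_ (column false) (column true) ⟩
      (if false xor last σ then T false else 0ℚ) + (if true xor last σ then T true else 0ℚ)
        ≡⟨ select (last σ) ⟩
      T (not (last σ))                                                ∎
      where
      open ≡-Reasoning
      h = λ z → tailInt 0 0 (proj₁ z) * tailInt m (bits→ℕ w) (proj₂ z)
      T = λ x → tailInt 0 0 (binFrac (x ∷ rev (ydigits⁻¹ x w))) * - q
      column : ∀ x → sumVecs m (h ∘ point a σ ∘ (_∷ʳ x)) ≡ (if x xor last σ then T x else 0ℚ)
      column x = begin
        sumVecs m (h ∘ point a σ ∘ (_∷ʳ x))
          ≡⟨ sumVecs-cong m (λ u → cong h (point-∷ʳ u x)) ⟩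
        sumVecs m (λ u → tailInt 0 0 (binFrac (x ∷ rev u)) * tailInt m (bits→ℕ w) (binFrac (ydigits x u ∷ʳ (x xor last σ))))
          ≡⟨ sumVecs-cong m (λ u → cong (tailInt 0 0 (binFrac (x ∷ rev u)) *_)
                (trans (tailInt-binFrac-∷ʳ (ydigits x u) w (x xor last σ))
                       (cong (λ b → if (x xor last σ) ∧ b then - q else 0ℚ) (does-ydigits x u w)))) ⟩
        sumVecs m (λ u → tailInt 0 0 (binFrac (x ∷ rev u)) * (if (x xor last σ) ∧ does (u ≟ᵛ ydigits⁻¹ x w) then - q else 0ℚ))
          ≡⟨ sumVecs-select m (ydigits⁻¹ x w) (x xor last σ) (- q) (λ u → tailInt 0 0 (binFrac (x ∷ rev u))) ⟩
        (if x xor last σ then T x else 0ℚ) ∎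
      select : ∀ l → (if false xor l then T false else 0ℚ) + (if true xor l then T true else 0ℚ) ≡ T (not l)
      select false = +-identityˡ (T true)
      select true  = +-identityʳ (T false)

    1/length≡q : ℤ.+ 1 / suc (length P ∸ 1) ≡ q
    1/length≡q = /-cong {ℤ.+ 1} {suc (length P ∸ 1)} {ℤ.+ 1} {2 ^ suc m} {{_}} {{ℕP.m^n≢0 2 (suc m)}}
                        refl (trans (ℕP.m+[n∸m]≡n 1≤length) length≡)
      where
      length≡ : length P ≡ 2 ^ suc m
      length≡ = trans (ListP.length-map (point a σ) (allVecs (suc m))) (length-allVecs (suc m))
      1≤length : 1 ℕ.≤ length P
      1≤length = subst (1 ℕ.≤_) (sym length≡) (ℕP.m^n>0 2 (suc m))

    haarCoeff-square : ∀ w → let μ = haarCoeff P (0 , m) (0 , bits→ℕ w)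
                                 V = bits→ℕ (rev (ydigits⁻¹ (not (last σ)) w)) in
      μ * μ ≡ q * q * (q * q) * ((V ⋆ q - ¼) * (V ⋆ q - ¼))
    haarCoeff-square w = trans (cong (λ μ → μ * μ) haarCoeff≡) (midpointCoeff-square M s (rev (ydigits⁻¹ s w)))
      where
      M = bits→ℕ w
      s = not (last σ)
      haarCoeff≡ : haarCoeff P (0 , m) (0 , M)
                   ≡ q * (tailInt 0 0 (binFrac (s ∷ rev (ydigits⁻¹ s w))) * - q) - momentInt 0 0 * momentInt m M
      haarCoeff≡ = cong₂ (λ c t → c * t - momentInt 0 0 * momentInt m M) 1/length≡q (sum-tailProducts w)

    sum-haarCoeff-squares :
      sumℚ (map (λ M → let μ = haarCoeff P (0 , m) (0 , M) in μ * μ) (upTo (2 ^ m)))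
        ≡ q * q * (q * q) * sumℚ (map (λ V → (V ⋆ q - ¼) * (V ⋆ q - ¼)) (upTo (2 ^ m)))
    sum-haarCoeff-squares = begin
      sumℚ (map μ² (upTo (2 ^ m)))                ≡⟨ sym (sumVecs-bits→ℕ m μ²) ⟩
      sumVecs m (μ² ∘ bits→ℕ)                     ≡⟨ sumVecs-cong m haarCoeff-square ⟩
      sumVecs m (G ∘ bits→ℕ ∘ rev ∘ ydigits⁻¹ s)  ≡⟨ sumVecs-ydigits⁻¹ s (G ∘ bits→ℕ ∘ rev) ⟩
      sumVecs m (G ∘ bits→ℕ ∘ rev)                ≡⟨ sumVecs-rev m (G ∘ bits→ℕ) ⟩
      sumVecs m (G ∘ bits→ℕ)                      ≡⟨ sumVecs-bits→ℕ m G ⟩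
      sumℚ (map G (upTo (2 ^ m)))                 ≡⟨ sumℚ-map-*ˡ (q * q * (q * q)) F (upTo (2 ^ m)) ⟩
      q * q * (q * q) * sumℚ (map F (upTo (2 ^ m))) ∎
      where
      open ≡-Reasoning
      s = not (last σ)
      μ² = λ M → haarCoeff P (0 , m) (0 , M) * haarCoeff P (0 , m) (0 , M)
      F = λ V → (V ⋆ q - ¼) * (V ⋆ q - ¼)
      G = λ V → q * q * (q * q) * F V

  2^-[4n+6] : ∀ n → 2^- (4 ℕ.* n ℕ.+ 6) ≡ 2^- n * 2^- n * (2^- n * 2^- n) * 2^- 6
  2^-[4n+6] n = begin
    2^- (4 ℕ.* n ℕ.+ 6)                        ≡⟨ cong 2^-_ (4n+6≡ n) ⟩
    2^- ((n ℕ.+ n) ℕ.+ (n ℕ.+ n) ℕ.+ 6)        ≡⟨ 2^-‿+ ((n ℕ.+ n) ℕ.+ (n ℕ.+ n)) 6 ⟩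
    2^- ((n ℕ.+ n) ℕ.+ (n ℕ.+ n)) * 2^- 6      ≡⟨ cong (_* 2^- 6) (2^-‿+ (n ℕ.+ n) (n ℕ.+ n)) ⟩
    2^- (n ℕ.+ n) * 2^- (n ℕ.+ n) * 2^- 6      ≡⟨ cong (λ p → p * p * 2^- 6) (2^-‿+ n n) ⟩
    2^- n * 2^- n * (2^- n * 2^- n) * 2^- 6    ∎
    where
    open ≡-Reasoning
    4n+6≡ : ∀ n → 4 ℕ.* n ℕ.+ 6 ≡ (n ℕ.+ n) ℕ.+ (n ℕ.+ n) ℕ.+ 6
    4n+6≡ = solve-∀

  ℕ→ℚ-2^[2n]+8 : ∀ n → ℕ→ℚ (2 ^ (2 ℕ.* n) ℕ.+ 8) ≡ ℕ→ℚ (2 ^ n) * ℕ→ℚ (2 ^ n) + ℕ→ℚ 8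
  ℕ→ℚ-2^[2n]+8 n = begin
    ℕ→ℚ (2 ^ (2 ℕ.* n) ℕ.+ 8)             ≡⟨ ℕ→ℚ-homo-+ (2 ^ (2 ℕ.* n)) 8 ⟩
    ℕ→ℚ (2 ^ (n ℕ.+ (n ℕ.+ 0))) + ℕ→ℚ 8   ≡⟨ cong (λ k → ℕ→ℚ (2 ^ (n ℕ.+ k)) + ℕ→ℚ 8) (ℕP.+-identityʳ n) ⟩
    ℕ→ℚ (2 ^ (n ℕ.+ n)) + ℕ→ℚ 8           ≡⟨ cong (λ k → ℕ→ℚ k + ℕ→ℚ 8) (ℕP.^-distribˡ-+-* 2 n n) ⟩
    ℕ→ℚ (2 ^ n ℕ.* 2 ^ n) + ℕ→ℚ 8         ≡⟨ cong (_+ ℕ→ℚ 8) (ℕ→ℚ-homo-* (2 ^ n) (2 ^ n)) ⟩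
    ℕ→ℚ (2 ^ n) * ℕ→ℚ (2 ^ n) + ℕ→ℚ 8     ∎
    where open ≡-Reasoning

  rhs-in-2^-n : ∀ n → let q = 2^- n in
    ℤ.+ 1 / 3 * 2^- (4 ℕ.* n ℕ.+ 6) * ℕ→ℚ (2 ^ (2 ℕ.* n) ℕ.+ 8) ≡ ℤ.+ 1 / 3 * 2^- 6 * (q * q + ℕ→ℚ 8 * (q * q * (q * q)))
  rhs-in-2^-n n = begin
    ℤ.+ 1 / 3 * 2^- (4 ℕ.* n ℕ.+ 6) * ℕ→ℚ (2 ^ (2 ℕ.* n) ℕ.+ 8)   ≡⟨ cong₂ (λ p x → ℤ.+ 1 / 3 * p * x) (2^-[4n+6] n) (ℕ→ℚ-2^[2n]+8 n) ⟩
    ℤ.+ 1 / 3 * (q * q * (q * q) * 2^- 6) * (N * N + ℕ→ℚ 8)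
      ≡⟨ solve 2 (λ q n → con (ℤ.+ 1 / 3) :* (q :* q :* (q :* q) :* con (2^- 6)) :* (n :* n :+ con (ℕ→ℚ 8))
                   := con (ℤ.+ 1 / 3) :* con (2^- 6) :* ((q :* n) :* (q :* n) :* (q :* q) :+ con (ℕ→ℚ 8) :* (q :* q :* (q :* q)))) refl q N ⟩
    ℤ.+ 1 / 3 * 2^- 6 * ((q * N) * (q * N) * (q * q) + ℕ→ℚ 8 * (q * q * (q * q)))
      ≡⟨ cong (λ u → ℤ.+ 1 / 3 * 2^- 6 * (u * u * (q * q) + ℕ→ℚ 8 * (q * q * (q * q)))) (2^-k*2^k≡1 n) ⟩
    ℤ.+ 1 / 3 * 2^- 6 * (1ℚ * 1ℚ * (q * q) + ℕ→ℚ 8 * (q * q * (q * q)))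
      ≡⟨ cong (λ x → ℤ.+ 1 / 3 * 2^- 6 * (x + ℕ→ℚ 8 * (q * q * (q * q)))) (*-identityˡ (q * q)) ⟩
    ℤ.+ 1 / 3 * 2^- 6 * (q * q + ℕ→ℚ 8 * (q * q * (q * q)))       ∎
    where
    open ≡-Reasoning
    q = 2^- n
    N = ℕ→ℚ (2 ^ n)

  haar-square-sum : ∀ m (a : Vec Bool m) (σ : Vec Bool (suc m)) →
    ℕ→ℚ (2 ^ m) * sumℚ (map (λ M → let μ = haarCoeff (pointSet (suc m) a σ) (0 , m) (0 , M) in μ * μ) (upTo (2 ^ m)))
      ≡ ℤ.+ 1 / 3 * 2^- (4 ℕ.* suc m ℕ.+ 6) * ℕ→ℚ (2 ^ (2 ℕ.* suc m) ℕ.+ 8)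
  haar-square-sum m a σ = begin
    N * sumℚ (map (λ M → let μ = haarCoeff (pointSet (suc m) a σ) (0 , m) (0 , M) in μ * μ) (upTo (2 ^ m)))
      ≡⟨ cong (N *_) (PointSet.sum-haarCoeff-squares a σ) ⟩
    N * (q * q * (q * q) * S)                     ≡⟨ solve 3 (λ n q s → n :* (q :* q :* (q :* q) :* s) := n :* q :* (q :* q) :* (q :* s)) refl N q S ⟩
    N * q * (q * q) * (q * S)                     ≡⟨ cong₂ (λ h r → h * (q * q) * r) (2^m⋆2^-[1+m]≡½ m) (*-sumℚ-square q ¼ (2 ^ m)) ⟩
    ½ * (q * q) * riemannSquare (2 ^ m ⋆ q) q ¼  ≡⟨ cong (λ L → ½ * (q * q) * riemannSquare L q ¼) (2^m⋆2^-[1+m]≡½ m) ⟩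
    ½ * (q * q) * riemannSquare ½ q ¼
      ≡⟨ solve 1 (λ q → con ½ :* (q :* q) :* (con ½ :* (con ½ :- q) :* (con ½ :+ con ½ :- q) :* con (ℤ.+ 1 / 6)
                          :- con ¼ :* con ½ :* (con ½ :- q) :+ con ½ :* con ¼ :* con ¼)
                   := con (ℤ.+ 1 / 3) :* con (2^- 6) :* (q :* q :+ con (ℕ→ℚ 8) :* (q :* q :* (q :* q)))) refl q ⟩
    ℤ.+ 1 / 3 * 2^- 6 * (q * q + ℕ→ℚ 8 * (q * q * (q * q)))   ≡⟨ sym (rhs-in-2^-n (suc m)) ⟩
    ℤ.+ 1 / 3 * 2^- (4 ℕ.* suc m ℕ.+ 6) * ℕ→ℚ (2 ^ (2 ℕ.* suc m) ℕ.+ 8) ∎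
    where
    open ≡-Reasoning
    N = ℕ→ℚ (2 ^ m)
    q = 2^- suc m
    S = sumℚ (map (λ V → (V ⋆ q - ¼) * (V ⋆ q - ¼)) (upTo (2 ^ m)))

open HaarSquareSum using (haar-square-sum)

open import Data.Bool using (Bool)
open import Data.Nat using (ℕ; _≤_; _∸_; _^_; _+_; _*_; suc; s≤s; z≤n)
open import Data.Vec using (Vec)
open import Data.List using (map; upTo)
open import Data.Product using (_,_)
open import Data.Rational as ℚ using (ℚ; _/_)
open import Data.Integer using (+_)
open import Relation.Binary.PropositionalEquality using (_≡_)

lemma10 : (n : ℕ) → 2 ≤ n → (a : Vec Bool (n ∸ 1)) → (σ : Vec Bool n) →
    ℕ→ℚ (2 ^ (n ∸ 1)) ℚ.*
      sumℚ (map (λ m₂ → let μ = haarCoeff (pointSet n a σ) (0 , n ∸ 1) (0 , m₂) in μ ℚ.* μ)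
                (upTo (2 ^ (n ∸ 1))))
      ≡ (+ 1) / 3 ℚ.* 2^- (4 * n + 6) ℚ.* ℕ→ℚ (2 ^ (2 * n) + 8)
lemma10 (suc (suc k)) (s≤s (s≤s z≤n)) a σ = haar-square-sum (suc k) a σ
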